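{- Let $F$ be a formula that is well-formed with respect to assignments $\Psi$ (of arity types to term variables) and $\Xi$ (of context variable types to context variables). Let $\theta$ be a closed substitution for all the variables assigned types by $\Psi$ such that $F[\theta]$ is defined, let $\Gamma$ be a context variable that possibly appears free in $F$, and let $\sigma$ be a closed substitution for all context variables other than $\Gamma$ that are assigned types by $\Xi$. Finally, let $G$ be a closed context expression such that $\vdash G\ \mathrm{ctx}$ is not derivable. Then (1) $F[\theta][\sigma][G/\Gamma]$ is valid if $\Gamma\vdash^+F$ is derivable; and (2) $F[\theta][\sigma][G/\Gamma]$ is not valid if $\Gamma\vdash^-F$ is derivable.
   Context: Canonical LF. Fix a well-formed LF signature $\Sigma$. Kinds, types and terms are $K ::= \mathrm{Type} \mid \Pi x{:}A.K$, $A,B ::= P \mid \Pi x{:}A.B$, $P ::= a \mid P\,M$, $M,N ::= R \mid \lambda x.M$, $R ::= c \mid x \mid R\,M$; only $\beta$-normal terms, well-typed ones $\eta$-long. Arity types are simple types over one base type $o$; erasure $P^-=o$, $(\Pi x{:}A_1.A_2)^-=A_1^-\to A_2^-$; $\Sigma^-=\{c{:}A^-\mid c{:}A\in\Sigma\}$. A substitution is a finite set $\theta=\{\langle x_i,M_i,\alpha_i\rangle\}$; $E[\theta]$ denotes its hereditary application, possibly undefined. Nominal constants and contexts. $\mathcal{N}$ is a set of nominal constants with arity types (infinitely many per arity type). Context expressions: $G ::= \Gamma\mid\cdot\mid G,n{:}A$. For closed expressions, $\vdash G\ \mathrm{ctx}$, $G\vdash A\ \mathrm{type}$, $G\vdash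 M\Leftarrow A$ are the canonical LF judgements with nominal constants in place of context-bound variables. Formulas of $\mathcal{L}_{LF}$: $F ::= \{G \vdash M : A\} \mid \top \mid \bot \mid F_1 \supset F_2 \mid F_1 \wedge F_2 \mid F_1 \vee F_2 \mid \forall x{:}\alpha.F \mid \exists x{:}\alpha.F \mid \Pi \Gamma{:}\mathcal{C}.F$ ($\mathcal{C}$ a context schema, i.e. a list of block schemas $\{x_1{:}\alpha_1,\ldots,x_n{:}\alpha_n\}y_1{:}A_1,\ldots,y_m{:}A_m$). $F$ is well-formed w.r.t. $\Psi,\Xi$ if its context variables are $\Pi$-bound or assigned by $\Xi$ and its terms/types are arity-well-formed w.r.t. $\Sigma^-$, $\mathcal{N}$, enclosing quantifiers and $\Psi$. $F[\theta]$, $F[\sigma]$, $F[G/\Gamma]$ are the (capture-avoiding) substitutions for term and context variables. The instances of $\mathcal{C}$ ($\mathcal{C}\leadsto G$) are concatenations of zero or more block-schema instances (each $y_j$ replaced by a distinct nominal constant of arity type $A_j^-$, each $x_i$ by a closed term $t_i$ with $\mathcal{N}\cup\Sigma^-\vdash t_i:\alpha_i$). Validity of closed formulas: $\{G\vdash M:A\}$ valid iff $\vdash G\ \mathrm{ctx}$, $G\vdash A\ \mathrm{type}$, $G\vdash M\Leftarrow A$ are derivable; $\top$ valid, $\bot$ not; $\supset,\wedge,\vee$ classical; $\Pi\Gamma{:}\mathcal{C}.F$ valid iff $F[G/\Gamma]$ valid for all $G$ with $\mathcal{C}\leadsto G$; $\forall x{:}\alpha.F$ (resp. $\exists$) valid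 iff $F[\{\langle x,M,\alpha\rangle\}]$ valid for all (resp. some) $M$ with $\mathcal{N}\cup\Sigma^-\vdash M:\alpha$. Ill-formedness analysis. $\Gamma\vdash^-F$ and $\Gamma\vdash^+F$ are the least relations with: $\Gamma\vdash^-\bot$; $\Gamma\vdash^-\{G\vdash M:A\}$ if $\Gamma$ appears in $G$; $\Gamma\vdash^-F_1\supset F_2$ if $\Gamma\vdash^+F_1$ and $\Gamma\vdash^-F_2$; $\Gamma\vdash^-F_1\vee F_2$ if $\Gamma\vdash^-F_1$ and $\Gamma\vdash^-F_2$; $\Gamma\vdash^-F_1\wedge F_2$ if $\Gamma\vdash^-F_i$ for some $i$; $\Gamma\vdash^+\top$; $\Gamma\vdash^+F_1\vee F_2$ if $\Gamma\vdash^+F_i$ for some $i$; $\Gamma\vdash^+F_1\wedge F_2$ if $\Gamma\vdash^+F_1$ and $\Gamma\vdash^+F_2$; $\Gamma\vdash^+F_1\supset F_2$ if $\Gamma\vdash^-F_1$ or $\Gamma\vdash^+F_2$; and for $\star\in\{+,-\}$: $\Gamma\vdash^\star\forall x{:}\alpha.F'$, $\Gamma\vdash^\star\exists x{:}\alpha.F'$, and (for $\Gamma'\ne\Gamma$) $\Gamma\vdash^\star\Pi\Gamma'{:}\mathcal{C}.F'$ whenever $\Gamma\vdash^\star F'$. -}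

module Defs where

-- LF-bound variables (λ, Π in types/kinds) are de Bruijn indices;
-- term variables of formulas (∀/∃-bound, or assigned by Ψ, or bound in
-- block schemas) are named (ℕ); context variables are named (ℕ);
-- nominal constants are pairs (name , arity type).

open import Data.Nat using (ℕ; zero; suc; _<_; pred; _≡ᵇ_; _≤ᵇ_)
open import Data.Bool using (Bool; true; false; if_then_else_)
open import Data.List using (List; []; _∷_; _++_; map; zipWith)
open import Data.Maybe using (Maybe; just; nothing; fromMaybe)
open import Data.Product using (Σ; _×_; _,_; proj₁; proj₂; Σ-syntax; ∃-syntax)
open import Data.Sum using (_⊎_; inj₁; inj₂)
open import Data.Empty using (⊥)
open import Data.Unit using (⊤)
open import Relation.Nullary using (¬_)
open import Relation.Binary.PropositionalEquality using (_≡_; _≢_)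
open import Data.List.Membership.Propositional using (_∈_; _∉_)
open import Data.List.Relation.Unary.All using (All)
open import Data.List.Relation.Unary.Unique.Propositional using (Unique)
open import Data.List.Relation.Binary.Pointwise using (Pointwise)

data Ar : Set where
  o   : Ar
  _⇒_ : Ar → Ar → Ar

infixr 5 _⇒_

Nom : Set
Nom = ℕ × Ar

-- Canonical LF syntax.  An atomic term R = h M1 ... Mn is written in
-- spine form  app h (M1 ∷ ... ∷ Mn ∷ []); likewise P = a M1 ... Mn.

data Head : Set where
  con : ℕ → Head
  nom : Nom → Head
  bv  : ℕ → Head
  fv  : ℕ → Head

data Tm : Set where
  lam : Tm → Tm
  app : Head → List Tm → Tm

data Ty : Set where
  base : ℕ → List Tm → Ty
  pi   : Ty → Ty → Ty       -- Π x:A. B   (B under one binder)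

data Kd : Set where
  type : Kd
  pi   : Ty → Kd → Kd       -- Π x:A. K   (K under one binder)

data CtxE : Set where
  cvar : ℕ → CtxE
  emp  : CtxE
  snoc : CtxE → Nom → Ty → CtxE

data Decl : Set where
  tyc : ℕ → Kd → Decl
  obc : ℕ → Ty → Decl

Sig : Set
Sig = List Decl          -- most recent declaration first

tycNames : Sig → List ℕ
tycNames [] = []
tycNames (tyc a _ ∷ S) = a ∷ tycNames S
tycNames (obc _ _ ∷ S) = tycNames S

obcNames : Sig → List ℕ
obcNames [] = []
obcNames (tyc _ _ ∷ S) = obcNames S
obcNames (obc c _ ∷ S) = c ∷ obcNames S

erase : Ty → Ar
erase (base _ _) = o
erase (pi A B)   = erase A ⇒ erase B

eraseK : Kd → Ar
eraseK type     = o
eraseK (pi A K) = erase A ⇒ eraseK K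

lookupN : {X : Set} → List (ℕ × X) → ℕ → Maybe X
lookupN [] x = nothing
lookupN ((y , a) ∷ l) x = if y ≡ᵇ x then just a else lookupN l x

delN : {X : Set} → ℕ → List (ℕ × X) → List (ℕ × X)
delN x [] = []
delN x ((y , a) ∷ l) = if y ≡ᵇ x then delN x l else (y , a) ∷ delN x l

dom : {X : Set} → List (ℕ × X) → List ℕ
dom = map proj₁

nth : {X : Set} → List X → ℕ → Maybe X
nth [] _ = nothing
nth (a ∷ l) zero = just a
nth (a ∷ l) (suc i) = nth l i

shiftH : ℕ → Head → Head
shiftH c (bv i) = if c ≤ᵇ i then bv (suc i) else bv i
shiftH c (con x) = con x
shiftH c (nom n) = nom n
shiftH c (fv x) = fv x

mutual
  shiftM : ℕ → Tm → Tm
  shiftM c (lam M) = lam (shiftM (suc c) M)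
  shiftM c (app h sp) = app (shiftH c h) (shiftSp c sp)

  shiftSp : ℕ → List Tm → List Tm
  shiftSp c [] = []
  shiftSp c (M ∷ sp) = shiftM c M ∷ shiftSp c sp

-- Hereditary substitution, as the graph of the partial function.
-- A substitution either replaces the LF-bound variable with index k
-- (indices above k are decremented), or replaces (named) term
-- variables by the terms of a substitution θ = {⟨x_i,M_i,α_i⟩}.

TSub : Set
TSub = List (ℕ × (Tm × Ar))

data Sb : Set where
  bvs : ℕ → Tm → Ar → Sb
  fvs : TSub → Sb

upS : Sb → Sb
upS (bvs k N α) = bvs (suc k) (shiftM 0 N) α
upS (fvs θ)     = fvs θ

data HdS : Sb → Head → Head ⊎ (Tm × Ar) → Set where
  con-s   : ∀ {s c} → HdS s (con c) (inj₁ (con c))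
  nom-s   : ∀ {s n} → HdS s (nom n) (inj₁ (nom n))
  bv-hit  : ∀ {k N α} → HdS (bvs k N α) (bv k) (inj₂ (N , α))
  bv-lt   : ∀ {k N α i} → i < k → HdS (bvs k N α) (bv i) (inj₁ (bv i))
  bv-gt   : ∀ {k N α i} → k < i → HdS (bvs k N α) (bv i) (inj₁ (bv (pred i)))
  bv-fvs  : ∀ {θ i} → HdS (fvs θ) (bv i) (inj₁ (bv i))
  fv-bvs  : ∀ {k N α x} → HdS (bvs k N α) (fv x) (inj₁ (fv x))
  fv-hit  : ∀ {θ x N α} → lookupN θ x ≡ just (N , α) → HdS (fvs θ) (fv x) (inj₂ (N , α))
  fv-miss : ∀ {θ x} → lookupN θ x ≡ nothing → HdS (fvs θ) (fv x) (inj₁ (fv x))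

mutual
  data SubM : Sb → Tm → Tm → Set where
    s-lam : ∀ {s M M'} → SubM (upS s) M M' → SubM s (lam M) (lam M')
    s-app : ∀ {s h h' sp sp'} → HdS s h (inj₁ h') → SubSp s sp sp' →
            SubM s (app h sp) (app h' sp')
    s-red : ∀ {s h N α sp sp' M'} → HdS s h (inj₂ (N , α)) → SubSp s sp sp' →
            Red α N sp' M' → SubM s (app h sp) M'

  data SubSp : Sb → List Tm → List Tm → Set where
    []  : ∀ {s} → SubSp s [] []
    _∷_ : ∀ {s M M' sp sp'} → SubM s M M' → SubSp s sp sp' → SubSp s (M ∷ sp) (M' ∷ sp')

  -- Red α N sp M' : hereditary reduction of N (of arity α) applied to sp
  data Red : Ar → Tm → List Tm → Tm → Set where
    r-nil : ∀ {α N} → Red α N [] N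
    r-lam : ∀ {α₁ α₂ P P' N₁ sp M'} → SubM (bvs 0 N₁ α₁) P P' → Red α₂ P' sp M' →
            Red (α₁ ⇒ α₂) (lam P) (N₁ ∷ sp) M'
    -- an atomic term (e.g. a nominal constant) at functional arity type
    r-atm : ∀ {α₁ α₂ h sp₀ N₁ sp M'} → Red α₂ (app h (sp₀ ++ (N₁ ∷ []))) sp M' →
            Red (α₁ ⇒ α₂) (app h sp₀) (N₁ ∷ sp) M'

data SubA : Sb → Ty → Ty → Set where
  sa-base : ∀ {s a sp sp'} → SubSp s sp sp' → SubA s (base a sp) (base a sp')
  sa-pi   : ∀ {s A A' B B'} → SubA s A A' → SubA (upS s) B B' → SubA s (pi A B) (pi A' B')

data SubK : Sb → Kd → Kd → Set where
  sk-type : ∀ {s} → SubK s type type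
  sk-pi   : ∀ {s A A' K K'} → SubA s A A' → SubK (upS s) K K' → SubK s (pi A K) (pi A' K')

data SubG : Sb → CtxE → CtxE → Set where
  sg-cvar : ∀ {s Γ} → SubG s (cvar Γ) (cvar Γ)
  sg-emp  : ∀ {s} → SubG s emp emp
  sg-snoc : ∀ {s G G' n A A'} → SubG s G G' → SubA s A A' → SubG s (snoc G n A) (snoc G' n A')

nomTm : Nom → Tm
nomTm n = app (nom n) []

ren : Nom → Ar → Sb
ren n α = bvs 0 (nomTm n) α

nomsH : Head → List Nom
nomsH (nom n) = n ∷ []
nomsH _ = []

mutual
  nomsM : Tm → List Nom
  nomsM (lam M) = nomsM M
  nomsM (app h sp) = nomsH h ++ nomsSp sp

  nomsSp : List Tm → List Nom
  nomsSp [] = []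
  nomsSp (M ∷ sp) = nomsM M ++ nomsSp sp

nomsTy : Ty → List Nom
nomsTy (base _ sp) = nomsSp sp
nomsTy (pi A B) = nomsTy A ++ nomsTy B

nomsKd : Kd → List Nom
nomsKd type = []
nomsKd (pi A K) = nomsTy A ++ nomsKd K

domG : CtxE → List Nom
domG (cvar _) = []
domG emp = []
domG (snoc G n _) = n ∷ domG G

data _∋_∶_ : CtxE → Nom → Ty → Set where
  here  : ∀ {G n A} → snoc G n A ∋ n ∶ A
  there : ∀ {G n A m B} → G ∋ n ∶ A → snoc G m B ∋ n ∶ A

data ClH (d : ℕ) : Head → Set where
  cl-con : ∀ {c} → ClH d (con c)
  cl-nom : ∀ {n} → ClH d (nom n)
  cl-bv  : ∀ {i} → i < d → ClH d (bv i)

mutual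
  data ClM : ℕ → Tm → Set where
    cl-lam : ∀ {d M} → ClM (suc d) M → ClM d (lam M)
    cl-app : ∀ {d h sp} → ClH d h → ClSp d sp → ClM d (app h sp)

  data ClSp : ℕ → List Tm → Set where
    []  : ∀ {d} → ClSp d []
    _∷_ : ∀ {d M sp} → ClM d M → ClSp d sp → ClSp d (M ∷ sp)

data ClTy : ℕ → Ty → Set where
  cl-base : ∀ {d a sp} → ClSp d sp → ClTy d (base a sp)
  cl-pi   : ∀ {d A B} → ClTy d A → ClTy (suc d) B → ClTy d (pi A B)

data ClG : CtxE → Set where
  cl-emp  : ClG emp
  cl-snoc : ∀ {G n A} → ClG G → ClTy 0 A → ClG (snoc G n A)

-- block schema {x1:α1,...,xn:αn} y1:A1,...,ym:Am  (xi, yj named term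
-- variables, bound in the block)
record Block : Set where
  constructor block
  field
    xs : List (ℕ × Ar)
    ys : List (ℕ × Ty)

Schema : Set
Schema = List Block

data Fm : Set where
  atm  : CtxE → Tm → Ty → Fm
  tt   : Fm
  ff   : Fm
  imp  : Fm → Fm → Fm
  conj : Fm → Fm → Fm
  disj : Fm → Fm → Fm
  all  : ℕ → Ar → Fm → Fm
  ex   : ℕ → Ar → Fm → Fm
  piC  : ℕ → Schema → Fm → Fm

-- F[θ] for term variables (θ closed), as a relation (possibly undefined)
data SubF : TSub → Fm → Fm → Set where
  sf-atm  : ∀ {θ G G' M M' A A'} → SubG (fvs θ) G G' → SubM (fvs θ) M M' →
            SubA (fvs θ) A A' → SubF θ (atm G M A) (atm G' M' A')
  sf-tt   : ∀ {θ} → SubF θ tt tt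
  sf-ff   : ∀ {θ} → SubF θ ff ff
  sf-imp  : ∀ {θ F₁ F₁' F₂ F₂'} → SubF θ F₁ F₁' → SubF θ F₂ F₂' → SubF θ (imp F₁ F₂) (imp F₁' F₂')
  sf-conj : ∀ {θ F₁ F₁' F₂ F₂'} → SubF θ F₁ F₁' → SubF θ F₂ F₂' → SubF θ (conj F₁ F₂) (conj F₁' F₂')
  sf-disj : ∀ {θ F₁ F₁' F₂ F₂'} → SubF θ F₁ F₁' → SubF θ F₂ F₂' → SubF θ (disj F₁ F₂) (disj F₁' F₂')
  sf-all  : ∀ {θ x α F F'} → SubF (delN x θ) F F' → SubF θ (all x α F) (all x α F')
  sf-ex   : ∀ {θ x α F F'} → SubF (delN x θ) F F' → SubF θ (ex x α F) (ex x α F')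
  sf-piC  : ∀ {θ Γ C F F'} → SubF θ F F' → SubF θ (piC Γ C F) (piC Γ C F')

CSub : Set
CSub = List (ℕ × CtxE)

csubG : CSub → CtxE → CtxE
csubG σ (cvar Γ) = fromMaybe (cvar Γ) (lookupN σ Γ)
csubG σ emp = emp
csubG σ (snoc G n A) = snoc (csubG σ G) n A

csubF : CSub → Fm → Fm
csubF σ (atm G M A) = atm (csubG σ G) M A
csubF σ tt = tt
csubF σ ff = ff
csubF σ (imp F₁ F₂) = imp (csubF σ F₁) (csubF σ F₂)
csubF σ (conj F₁ F₂) = conj (csubF σ F₁) (csubF σ F₂)
csubF σ (disj F₁ F₂) = disj (csubF σ F₁) (csubF σ F₂)
csubF σ (all x α F) = all x α (csubF σ F)
csubF σ (ex x α F) = ex x α (csubF σ F)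
csubF σ (piC Γ C F) = piC Γ C (csubF (delN Γ σ) F)

module _ (S : Sig) where

  -- Arity typing w.r.t. Σ⁻, the nominal constants, Ψ (types of term
  -- variables) and Δ (arity types of enclosing LF binders)

  data AH (Ψ : List (ℕ × Ar)) (Δ : List Ar) : Head → Ar → Set where
    ah-con : ∀ {c A} → obc c A ∈ S → AH Ψ Δ (con c) (erase A)
    ah-nom : ∀ {n α} → AH Ψ Δ (nom (n , α)) α
    ah-bv  : ∀ {i α} → nth Δ i ≡ just α → AH Ψ Δ (bv i) α
    ah-fv  : ∀ {x α} → lookupN Ψ x ≡ just α → AH Ψ Δ (fv x) α

  mutual
    data AM (Ψ : List (ℕ × Ar)) : List Ar → Tm → Ar → Set where
      am-lam : ∀ {Δ M α₁ α₂} → AM Ψ (α₁ ∷ Δ) M α₂ → AM Ψ Δ (lam M) (α₁ ⇒ α₂)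
      am-app : ∀ {Δ h sp α β} → AH Ψ Δ h α → ASp Ψ Δ α sp β → AM Ψ Δ (app h sp) β

    data ASp (Ψ : List (ℕ × Ar)) : List Ar → Ar → List Tm → Ar → Set where
      []  : ∀ {Δ α} → ASp Ψ Δ α [] α
      _∷_ : ∀ {Δ M α₁ α₂ sp β} → AM Ψ Δ M α₁ → ASp Ψ Δ α₂ sp β → ASp Ψ Δ (α₁ ⇒ α₂) (M ∷ sp) β

  data ATy (Ψ : List (ℕ × Ar)) : List Ar → Ty → Set where
    aty-base : ∀ {Δ a K sp} → tyc a K ∈ S → ASp Ψ Δ (eraseK K) sp o → ATy Ψ Δ (base a sp)
    aty-pi   : ∀ {Δ A B} → ATy Ψ Δ A → ATy Ψ (erase A ∷ Δ) B → ATy Ψ Δ (pi A B)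

  -- cs: context variables in scope
  data ACtx (Ψ : List (ℕ × Ar)) (cs : List ℕ) : CtxE → Set where
    actx-cvar : ∀ {Γ} → Γ ∈ cs → ACtx Ψ cs (cvar Γ)
    actx-emp  : ACtx Ψ cs emp
    actx-snoc : ∀ {G n A} → ACtx Ψ cs G → ATy Ψ [] A → ACtx Ψ cs (snoc G n A)

  -- well-formedness of formulas w.r.t. Ψ and (the domain of) Ξ
  data WfF : List (ℕ × Ar) → List ℕ → Fm → Set where
    wf-atm  : ∀ {Ψ cs G M A} → ACtx Ψ cs G → ATy Ψ [] A → AM Ψ [] M (erase A) →
              WfF Ψ cs (atm G M A)
    wf-tt   : ∀ {Ψ cs} → WfF Ψ cs tt
    wf-ff   : ∀ {Ψ cs} → WfF Ψ cs ff
    wf-imp  : ∀ {Ψ cs F₁ F₂} → WfF Ψ cs F₁ → WfF Ψ cs F₂ → WfF Ψ cs (imp F₁ F₂)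
    wf-conj : ∀ {Ψ cs F₁ F₂} → WfF Ψ cs F₁ → WfF Ψ cs F₂ → WfF Ψ cs (conj F₁ F₂)
    wf-disj : ∀ {Ψ cs F₁ F₂} → WfF Ψ cs F₁ → WfF Ψ cs F₂ → WfF Ψ cs (disj F₁ F₂)
    wf-all  : ∀ {Ψ cs x α F} → WfF ((x , α) ∷ Ψ) cs F → WfF Ψ cs (all x α F)
    wf-ex   : ∀ {Ψ cs x α F} → WfF ((x , α) ∷ Ψ) cs F → WfF Ψ cs (ex x α F)
    wf-piC  : ∀ {Ψ cs Γ C F} → WfF Ψ (Γ ∷ cs) F → WfF Ψ cs (piC Γ C F)

  -- Canonical LF judgements for closed expressions, with nominal
  -- constants in place of context-bound variables

  mutual
    data CtxOK : CtxE → Set where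
      c-emp  : CtxOK emp
      c-snoc : ∀ {G n A} → CtxOK G → n ∉ domG G → IsType G A → proj₂ n ≡ erase A →
               CtxOK (snoc G n A)

    data IsKind : CtxE → Kd → Set where
      k-type : ∀ {G} → IsKind G type
      k-pi   : ∀ {G A K K' n} → IsType G A → n ∉ domG G → n ∉ nomsKd K →
               proj₂ n ≡ erase A → SubK (ren n (erase A)) K K' →
               IsKind (snoc G n A) K' → IsKind G (pi A K)

    data IsType : CtxE → Ty → Set where
      t-base : ∀ {G a K sp} → tyc a K ∈ S → SpK G K sp type → IsType G (base a sp)
      t-pi   : ∀ {G A B B' n} → IsType G A → n ∉ domG G → n ∉ nomsTy B →
               proj₂ n ≡ erase A → SubA (ren n (erase A)) B B' →
               IsType (snoc G n A) B' → IsType G (pi A B)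

    data SpK : CtxE → Kd → List Tm → Kd → Set where
      []  : ∀ {G K} → SpK G K [] K
      spk : ∀ {G A K K₁ K₂ M sp} → Chk G M A → SubK (bvs 0 M (erase A)) K K₁ →
            SpK G K₁ sp K₂ → SpK G (pi A K) (M ∷ sp) K₂

    data SynH : CtxE → Head → Ty → Set where
      h-con : ∀ {G c A} → obc c A ∈ S → SynH G (con c) A
      h-nom : ∀ {G n A} → G ∋ n ∶ A → SynH G (nom n) A

    data SpA : CtxE → Ty → List Tm → Ty → Set where
      []  : ∀ {G A} → SpA G A [] A
      spa : ∀ {G A B B₁ C M sp} → Chk G M A → SubA (bvs 0 M (erase A)) B B₁ →
            SpA G B₁ sp C → SpA G (pi A B) (M ∷ sp) C

    data Chk : CtxE → Tm → Ty → Set where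
      ch-atm : ∀ {G h A sp a sp'} → SynH G h A → SpA G A sp (base a sp') →
               Chk G (app h sp) (base a sp')
      ch-lam : ∀ {G M M' A B B' n} → n ∉ domG G → n ∉ nomsM M → n ∉ nomsTy B →
               proj₂ n ≡ erase A → SubM (ren n (erase A)) M M' →
               SubA (ren n (erase A)) B B' → Chk (snoc G n A) M' B' →
               Chk G (lam M) (pi A B)

  zipX : List (ℕ × Ar) → List Tm → TSub
  zipX = zipWith (λ xa t → proj₁ xa , (t , proj₂ xa))

  zipY : List (ℕ × Ty) → List Nom → TSub
  zipY = zipWith (λ yA n → proj₁ yA , (nomTm n , erase (proj₂ yA)))

  data Ext (θ : TSub) : List (ℕ × Ty) → List Nom → CtxE → CtxE → Set where
    e-nil  : ∀ {G} → Ext θ [] [] G G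
    e-cons : ∀ {y A A' ys n ns G G'} → SubA (fvs θ) A A' →
             Ext θ ys ns (snoc G n A') G' → Ext θ ((y , A) ∷ ys) (n ∷ ns) G G'

  InstB : Block → CtxE → CtxE → Set
  InstB (block xs ys) G G' =
    Σ[ ts ∈ List Tm ] Σ[ ns ∈ List Nom ]
      ( Pointwise (λ xa t → AM [] [] t (proj₂ xa)) xs ts
      × Pointwise (λ yA n → proj₂ n ≡ erase (proj₂ yA)) ys ns
      × Unique ns
      × Ext (zipX xs ts ++ zipY ys ns) ys ns G G' )

  data InstC (C : Schema) : CtxE → Set where
    i-emp : InstC C emp
    i-blk : ∀ {b G G'} → InstC C G → b ∈ C → InstB b G G' → InstC C G'

  -- Validity.  Valid' ρ κ F is validity of F[ρ][κ] where ρ, κ collect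
  -- the closed terms/contexts chosen for enclosing quantifiers.

  Valid' : TSub → CSub → Fm → Set
  Valid' ρ κ (atm G M A) =
    Σ[ G' ∈ CtxE ] Σ[ M' ∈ Tm ] Σ[ A' ∈ Ty ]
      ( SubG (fvs ρ) (csubG κ G) G' × SubM (fvs ρ) M M' × SubA (fvs ρ) A A'
      × CtxOK G' × IsType G' A' × Chk G' M' A' )
  Valid' ρ κ tt = ⊤
  Valid' ρ κ ff = ⊥
  Valid' ρ κ (imp F₁ F₂) = Valid' ρ κ F₁ → Valid' ρ κ F₂
  Valid' ρ κ (conj F₁ F₂) = Valid' ρ κ F₁ × Valid' ρ κ F₂
  Valid' ρ κ (disj F₁ F₂) = Valid' ρ κ F₁ ⊎ Valid' ρ κ F₂
  Valid' ρ κ (all x α F) = (M : Tm) → AM [] [] M α → Valid' ((x , (M , α)) ∷ ρ) κ F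
  Valid' ρ κ (ex x α F) = Σ[ M ∈ Tm ] (AM [] [] M α × Valid' ((x , (M , α)) ∷ ρ) κ F)
  Valid' ρ κ (piC Γ C F) = (G : CtxE) → InstC C G → Valid' ρ ((Γ , G) ∷ κ) F

  Valid : Fm → Set
  Valid = Valid' [] []


  ClosedSubFor : List (ℕ × Ar) → TSub → Set
  ClosedSubFor Ψ θ =
      (∀ x α → lookupN Ψ x ≡ just α → ∃[ M ] (lookupN θ x ≡ just (M , α)))
    × All (λ e → proj₁ e ∈ dom Ψ × AM [] [] (proj₁ (proj₂ e)) (proj₂ (proj₂ e))) θ

-- Signature well-formedness (outside the module, since the judgement
-- for each declaration is relative to the preceding signature)

data ⊢sig : Sig → Set where
  sig-emp : ⊢sig []
  sig-tyc : ∀ {S a K} → ⊢sig S → a ∉ tycNames S → IsKind S emp K → ⊢sig (tyc a K ∷ S)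
  sig-obc : ∀ {S c A} → ⊢sig S → c ∉ obcNames S → IsType S emp A → ⊢sig (obc c A ∷ S)

CtxSubFor : List (ℕ × Schema) → ℕ → CSub → Set
CtxSubFor Ξ Γ σ =
    All (λ e → ClG (proj₂ e)) σ
  × Γ ∉ dom σ
  × (∀ Γ' → Γ' ∈ dom Ξ → Γ' ≢ Γ → Γ' ∈ dom σ)
  × (∀ Γ' → Γ' ∈ dom σ → Γ' ∈ dom Ξ)

data Appears (Γ : ℕ) : CtxE → Set where
  ap-here : Appears Γ (cvar Γ)
  ap-snoc : ∀ {G n A} → Appears Γ G → Appears Γ (snoc G n A)

mutual
  data _⊢⁻_ (Γ : ℕ) : Fm → Set where
    n-ff    : Γ ⊢⁻ ff
    n-atm   : ∀ {G M A} → Appears Γ G → Γ ⊢⁻ atm G M A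
    n-imp   : ∀ {F₁ F₂} → Γ ⊢⁺ F₁ → Γ ⊢⁻ F₂ → Γ ⊢⁻ imp F₁ F₂
    n-disj  : ∀ {F₁ F₂} → Γ ⊢⁻ F₁ → Γ ⊢⁻ F₂ → Γ ⊢⁻ disj F₁ F₂
    n-conj₁ : ∀ {F₁ F₂} → Γ ⊢⁻ F₁ → Γ ⊢⁻ conj F₁ F₂
    n-conj₂ : ∀ {F₁ F₂} → Γ ⊢⁻ F₂ → Γ ⊢⁻ conj F₁ F₂
    n-all   : ∀ {x α F} → Γ ⊢⁻ F → Γ ⊢⁻ all x α F
    n-ex    : ∀ {x α F} → Γ ⊢⁻ F → Γ ⊢⁻ ex x α F
    n-piC   : ∀ {Γ' C F} → Γ' ≢ Γ → Γ ⊢⁻ F → Γ ⊢⁻ piC Γ' C F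

  data _⊢⁺_ (Γ : ℕ) : Fm → Set where
    p-tt    : Γ ⊢⁺ tt
    p-disj₁ : ∀ {F₁ F₂} → Γ ⊢⁺ F₁ → Γ ⊢⁺ disj F₁ F₂
    p-disj₂ : ∀ {F₁ F₂} → Γ ⊢⁺ F₂ → Γ ⊢⁺ disj F₁ F₂
    p-conj  : ∀ {F₁ F₂} → Γ ⊢⁺ F₁ → Γ ⊢⁺ F₂ → Γ ⊢⁺ conj F₁ F₂
    p-imp₁  : ∀ {F₁ F₂} → Γ ⊢⁻ F₁ → Γ ⊢⁺ imp F₁ F₂
    p-imp₂  : ∀ {F₁ F₂} → Γ ⊢⁺ F₂ → Γ ⊢⁺ imp F₁ F₂
    p-all   : ∀ {x α F} → Γ ⊢⁺ F → Γ ⊢⁺ all x α F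
    p-ex    : ∀ {x α F} → Γ ⊢⁺ F → Γ ⊢⁺ ex x α F
    p-piC   : ∀ {Γ' C F} → Γ' ≢ Γ → Γ ⊢⁺ F → Γ ⊢⁺ piC Γ' C F

{-# OPTIONS --safe #-}
module Submission where

-- If Γ appears in a context expression H, then H[G/Γ] extends G, and
-- since well-formed LF contexts are closed under prefixes, every atomic
-- formula {H ⊢ M : A} with Γ in H becomes invalid once G is ill-formed.
-- The substitutions θ and σ leave the occurrences of Γ in place, so an
-- induction over Γ ⊢⁺ F / Γ ⊢⁻ F finishes the argument; in the quantifier
-- cases it uses that quantifier domains are never empty: a nominal
-- constant inhabits every arity type, and every context schema has the
-- empty context as an instance.

open import Defs
open import Data.Nat using (ℕ; _≡ᵇ_)
open import Data.Nat.Properties using (≡ᵇ⇒≡; ≡⇒≡ᵇ)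
open import Data.Bool using (true; false)
open import Data.Bool.Properties using (T-≡)
open import Data.Maybe using (just; nothing)
open import Data.List using (List; []; _∷_)
open import Data.List.Membership.Propositional using (_∉_)
open import Data.List.Relation.Unary.Any using (here; there)
open import Data.Product using (_×_; _,_)
open import Data.Sum using (inj₁; inj₂)
open import Data.Empty using (⊥-elim)
open import Data.Unit using (tt)
open import Function.Bundles using (Equivalence)
open import Relation.Nullary using (¬_)
open import Relation.Binary.PropositionalEquality
  using (_≡_; _≢_; refl; sym; trans; cong; cong₂; subst)

≡ᵇ-refl : ∀ n → (n ≡ᵇ n) ≡ true
≡ᵇ-refl n = Equivalence.to T-≡ (≡⇒≡ᵇ n n refl)

≡ᵇ-true⇒≡ : ∀ m n → (m ≡ᵇ n) ≡ true → m ≡ n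
≡ᵇ-true⇒≡ m n e = ≡ᵇ⇒≡ m n (Equivalence.from T-≡ e)

lookupN-delN-≢ : {X : Set} {x y : ℕ} → x ≢ y → (l : List (ℕ × X)) →
                 lookupN (delN x l) y ≡ lookupN l y
lookupN-delN-≢ x≢y [] = refl
lookupN-delN-≢ {x = x} {y} x≢y ((z , a) ∷ l) with z ≡ᵇ x in z≡x | z ≡ᵇ y in z≡y
... | true  | true  = ⊥-elim (x≢y (trans (sym (≡ᵇ-true⇒≡ z x z≡x)) (≡ᵇ-true⇒≡ z y z≡y)))
... | true  | false = lookupN-delN-≢ x≢y l
... | false | true  rewrite z≡y = refl
... | false | false rewrite z≡y = lookupN-delN-≢ x≢y l

lookupN-∉-dom : {X : Set} {x : ℕ} (l : List (ℕ × X)) → x ∉ dom l → lookupN l x ≡ nothing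
lookupN-∉-dom [] _ = refl
lookupN-∉-dom {x = x} ((y , a) ∷ l) x∉ with y ≡ᵇ x in y≡x
... | true  = ⊥-elim (x∉ (here (sym (≡ᵇ-true⇒≡ y x y≡x))))
... | false = lookupN-∉-dom l (λ x∈ → x∉ (there x∈))

mutual
  SubM-fvs-closed : ∀ {ρ d M M'} → ClM d M → SubM (fvs ρ) M M' → M' ≡ M
  SubM-fvs-closed (cl-lam c) (s-lam s) = cong lam (SubM-fvs-closed c s)
  SubM-fvs-closed (cl-app cl-con c) (s-app con-s s) = cong (app _) (SubSp-fvs-closed c s)
  SubM-fvs-closed (cl-app cl-nom c) (s-app nom-s s) = cong (app _) (SubSp-fvs-closed c s)
  SubM-fvs-closed (cl-app (cl-bv _) c) (s-app bv-fvs s) = cong (app _) (SubSp-fvs-closed c s)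
  SubM-fvs-closed (cl-app cl-con _) (s-red () _ _)
  SubM-fvs-closed (cl-app cl-nom _) (s-red () _ _)
  SubM-fvs-closed (cl-app (cl-bv _) _) (s-red () _ _)

  SubSp-fvs-closed : ∀ {ρ d sp sp'} → ClSp d sp → SubSp (fvs ρ) sp sp' → sp' ≡ sp
  SubSp-fvs-closed [] [] = refl
  SubSp-fvs-closed (c ∷ cs) (s ∷ ss) = cong₂ _∷_ (SubM-fvs-closed c s) (SubSp-fvs-closed cs ss)

SubA-fvs-closed : ∀ {ρ d A A'} → ClTy d A → SubA (fvs ρ) A A' → A' ≡ A
SubA-fvs-closed (cl-base c) (sa-base s) = cong (base _) (SubSp-fvs-closed c s)
SubA-fvs-closed (cl-pi c c') (sa-pi s s') = cong₂ pi (SubA-fvs-closed c s) (SubA-fvs-closed c' s')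

SubG-fvs-closed : ∀ {ρ G G'} → ClG G → SubG (fvs ρ) G G' → G' ≡ G
SubG-fvs-closed cl-emp sg-emp = refl
SubG-fvs-closed (cl-snoc c a) (sg-snoc s s') =
  cong₂ (λ H A → snoc H _ A) (SubG-fvs-closed c s) (SubA-fvs-closed a s')

csubG-closed : ∀ κ {G} → ClG G → csubG κ G ≡ G
csubG-closed κ cl-emp = refl
csubG-closed κ (cl-snoc c _) = cong (λ H → snoc H _ _) (csubG-closed κ c)

data _≼_ (G : CtxE) : CtxE → Set where
  ≼-refl : G ≼ G
  ≼-snoc : ∀ {H n A} → G ≼ H → G ≼ snoc H n A

CtxOK-≼ : ∀ {S G H} → G ≼ H → CtxOK S H → CtxOK S G
CtxOK-≼ ≼-refl ok = ok
CtxOK-≼ (≼-snoc G≼H) (c-snoc ok _ _ _) = CtxOK-≼ G≼H ok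

≼-csubG : ∀ κ {G H} → ClG G → G ≼ H → G ≼ csubG κ H
≼-csubG κ clG ≼-refl = subst (_ ≼_) (sym (csubG-closed κ clG)) ≼-refl
≼-csubG κ clG (≼-snoc G≼H) = ≼-snoc (≼-csubG κ clG G≼H)

≼-SubG : ∀ {ρ G H H'} → ClG G → G ≼ H → SubG (fvs ρ) H H' → G ≼ H'
≼-SubG clG ≼-refl s = subst (_ ≼_) (sym (SubG-fvs-closed clG s)) ≼-refl
≼-SubG clG (≼-snoc G≼H) (sg-snoc s _) = ≼-snoc (≼-SubG clG G≼H s)

Appears⇒≼-csubG : ∀ {Γ τ G H} → lookupN τ Γ ≡ just G → Appears Γ H → G ≼ csubG τ H
Appears⇒≼-csubG τΓ≡G ap-here rewrite τΓ≡G = ≼-refl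
Appears⇒≼-csubG τΓ≡G (ap-snoc a) = ≼-snoc (Appears⇒≼-csubG τΓ≡G a)

Appears-csubG : ∀ {Γ σ H} → lookupN σ Γ ≡ nothing → Appears Γ H → Appears Γ (csubG σ H)
Appears-csubG σΓ≡∅ ap-here rewrite σΓ≡∅ = ap-here
Appears-csubG σΓ≡∅ (ap-snoc a) = ap-snoc (Appears-csubG σΓ≡∅ a)

Appears-SubG : ∀ {Γ s H H'} → SubG s H H' → Appears Γ H → Appears Γ H'
Appears-SubG sg-cvar ap-here = ap-here
Appears-SubG (sg-snoc s _) (ap-snoc a) = ap-snoc (Appears-SubG s a)

mutual
  ⊢⁺-SubF : ∀ {Γ θ F F'} → SubF θ F F' → Γ ⊢⁺ F → Γ ⊢⁺ F'
  ⊢⁺-SubF sf-tt p-tt = p-tt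
  ⊢⁺-SubF (sf-disj s _) (p-disj₁ p) = p-disj₁ (⊢⁺-SubF s p)
  ⊢⁺-SubF (sf-disj _ s) (p-disj₂ p) = p-disj₂ (⊢⁺-SubF s p)
  ⊢⁺-SubF (sf-conj s t) (p-conj p q) = p-conj (⊢⁺-SubF s p) (⊢⁺-SubF t q)
  ⊢⁺-SubF (sf-imp s _) (p-imp₁ n) = p-imp₁ (⊢⁻-SubF s n)
  ⊢⁺-SubF (sf-imp _ s) (p-imp₂ p) = p-imp₂ (⊢⁺-SubF s p)
  ⊢⁺-SubF (sf-all s) (p-all p) = p-all (⊢⁺-SubF s p)
  ⊢⁺-SubF (sf-ex s) (p-ex p) = p-ex (⊢⁺-SubF s p)
  ⊢⁺-SubF (sf-piC s) (p-piC ne p) = p-piC ne (⊢⁺-SubF s p)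

  ⊢⁻-SubF : ∀ {Γ θ F F'} → SubF θ F F' → Γ ⊢⁻ F → Γ ⊢⁻ F'
  ⊢⁻-SubF sf-ff n-ff = n-ff
  ⊢⁻-SubF (sf-atm g _ _) (n-atm a) = n-atm (Appears-SubG g a)
  ⊢⁻-SubF (sf-imp s t) (n-imp p n) = n-imp (⊢⁺-SubF s p) (⊢⁻-SubF t n)
  ⊢⁻-SubF (sf-disj s t) (n-disj n m) = n-disj (⊢⁻-SubF s n) (⊢⁻-SubF t m)
  ⊢⁻-SubF (sf-conj s _) (n-conj₁ n) = n-conj₁ (⊢⁻-SubF s n)
  ⊢⁻-SubF (sf-conj _ s) (n-conj₂ n) = n-conj₂ (⊢⁻-SubF s n)
  ⊢⁻-SubF (sf-all s) (n-all n) = n-all (⊢⁻-SubF s n)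
  ⊢⁻-SubF (sf-ex s) (n-ex n) = n-ex (⊢⁻-SubF s n)
  ⊢⁻-SubF (sf-piC s) (n-piC ne n) = n-piC ne (⊢⁻-SubF s n)

mutual
  ⊢⁺-csubF : ∀ {Γ F} σ → lookupN σ Γ ≡ nothing → Γ ⊢⁺ F → Γ ⊢⁺ csubF σ F
  ⊢⁺-csubF σ σΓ≡∅ p-tt = p-tt
  ⊢⁺-csubF σ σΓ≡∅ (p-disj₁ p) = p-disj₁ (⊢⁺-csubF σ σΓ≡∅ p)
  ⊢⁺-csubF σ σΓ≡∅ (p-disj₂ p) = p-disj₂ (⊢⁺-csubF σ σΓ≡∅ p)
  ⊢⁺-csubF σ σΓ≡∅ (p-conj p q) = p-conj (⊢⁺-csubF σ σΓ≡∅ p) (⊢⁺-csubF σ σΓ≡∅ q)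
  ⊢⁺-csubF σ σΓ≡∅ (p-imp₁ n) = p-imp₁ (⊢⁻-csubF σ σΓ≡∅ n)
  ⊢⁺-csubF σ σΓ≡∅ (p-imp₂ p) = p-imp₂ (⊢⁺-csubF σ σΓ≡∅ p)
  ⊢⁺-csubF σ σΓ≡∅ (p-all p) = p-all (⊢⁺-csubF σ σΓ≡∅ p)
  ⊢⁺-csubF σ σΓ≡∅ (p-ex p) = p-ex (⊢⁺-csubF σ σΓ≡∅ p)
  ⊢⁺-csubF σ σΓ≡∅ (p-piC {Γ'} ne p) =
    p-piC ne (⊢⁺-csubF (delN Γ' σ) (trans (lookupN-delN-≢ ne σ) σΓ≡∅) p)

  ⊢⁻-csubF : ∀ {Γ F} σ → lookupN σ Γ ≡ nothing → Γ ⊢⁻ F → Γ ⊢⁻ csubF σ F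
  ⊢⁻-csubF σ σΓ≡∅ n-ff = n-ff
  ⊢⁻-csubF σ σΓ≡∅ (n-atm a) = n-atm (Appears-csubG σΓ≡∅ a)
  ⊢⁻-csubF σ σΓ≡∅ (n-imp p n) = n-imp (⊢⁺-csubF σ σΓ≡∅ p) (⊢⁻-csubF σ σΓ≡∅ n)
  ⊢⁻-csubF σ σΓ≡∅ (n-disj n m) = n-disj (⊢⁻-csubF σ σΓ≡∅ n) (⊢⁻-csubF σ σΓ≡∅ m)
  ⊢⁻-csubF σ σΓ≡∅ (n-conj₁ n) = n-conj₁ (⊢⁻-csubF σ σΓ≡∅ n)
  ⊢⁻-csubF σ σΓ≡∅ (n-conj₂ n) = n-conj₂ (⊢⁻-csubF σ σΓ≡∅ n)
  ⊢⁻-csubF σ σΓ≡∅ (n-all n) = n-all (⊢⁻-csubF σ σΓ≡∅ n)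
  ⊢⁻-csubF σ σΓ≡∅ (n-ex n) = n-ex (⊢⁻-csubF σ σΓ≡∅ n)
  ⊢⁻-csubF σ σΓ≡∅ (n-piC {Γ'} ne n) =
    n-piC ne (⊢⁻-csubF (delN Γ' σ) (trans (lookupN-delN-≢ ne σ) σΓ≡∅) n)

AM-nomTm : ∀ S n α → AM S [] [] (nomTm (n , α)) α
AM-nomTm S n α = am-app ah-nom []

module IllFormedContext (S : Sig) (Γ : ℕ) (G : CtxE) (clG : ClG G) (G-bad : ¬ CtxOK S G) where

  mutual
    ⊢⁺⇒Valid' : ∀ {F} τ ρ κ → lookupN τ Γ ≡ just G → Γ ⊢⁺ F → Valid' S ρ κ (csubF τ F)
    ⊢⁺⇒Valid' τ ρ κ τΓ≡G p-tt = tt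
    ⊢⁺⇒Valid' τ ρ κ τΓ≡G (p-disj₁ p) = inj₁ (⊢⁺⇒Valid' τ ρ κ τΓ≡G p)
    ⊢⁺⇒Valid' τ ρ κ τΓ≡G (p-disj₂ p) = inj₂ (⊢⁺⇒Valid' τ ρ κ τΓ≡G p)
    ⊢⁺⇒Valid' τ ρ κ τΓ≡G (p-conj p q) = ⊢⁺⇒Valid' τ ρ κ τΓ≡G p , ⊢⁺⇒Valid' τ ρ κ τΓ≡G q
    ⊢⁺⇒Valid' τ ρ κ τΓ≡G (p-imp₁ n) = λ v → ⊥-elim (⊢⁻⇒¬Valid' τ ρ κ τΓ≡G n v)
    ⊢⁺⇒Valid' τ ρ κ τΓ≡G (p-imp₂ p) = λ _ → ⊢⁺⇒Valid' τ ρ κ τΓ≡G p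
    ⊢⁺⇒Valid' τ ρ κ τΓ≡G (p-all p) = λ _ _ → ⊢⁺⇒Valid' τ _ κ τΓ≡G p
    ⊢⁺⇒Valid' τ ρ κ τΓ≡G (p-ex {α = α} p) =
      nomTm (0 , α) , AM-nomTm S 0 α , ⊢⁺⇒Valid' τ _ κ τΓ≡G p
    ⊢⁺⇒Valid' τ ρ κ τΓ≡G (p-piC {Γ'} ne p) =
      λ _ _ → ⊢⁺⇒Valid' (delN Γ' τ) ρ _ (trans (lookupN-delN-≢ ne τ) τΓ≡G) p

    ⊢⁻⇒¬Valid' : ∀ {F} τ ρ κ → lookupN τ Γ ≡ just G → Γ ⊢⁻ F → ¬ Valid' S ρ κ (csubF τ F)
    ⊢⁻⇒¬Valid' τ ρ κ τΓ≡G n-ff v = v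
    ⊢⁻⇒¬Valid' τ ρ κ τΓ≡G (n-atm a) (_ , _ , _ , sg , _ , _ , ok , _) =
      G-bad (CtxOK-≼ (≼-SubG clG (≼-csubG κ clG (Appears⇒≼-csubG τΓ≡G a)) sg) ok)
    ⊢⁻⇒¬Valid' τ ρ κ τΓ≡G (n-imp p n) f = ⊢⁻⇒¬Valid' τ ρ κ τΓ≡G n (f (⊢⁺⇒Valid' τ ρ κ τΓ≡G p))
    ⊢⁻⇒¬Valid' τ ρ κ τΓ≡G (n-disj n m) (inj₁ v) = ⊢⁻⇒¬Valid' τ ρ κ τΓ≡G n v
    ⊢⁻⇒¬Valid' τ ρ κ τΓ≡G (n-disj n m) (inj₂ v) = ⊢⁻⇒¬Valid' τ ρ κ τΓ≡G m v
    ⊢⁻⇒¬Valid' τ ρ κ τΓ≡G (n-conj₁ n) (v , _) = ⊢⁻⇒¬Valid' τ ρ κ τΓ≡G n v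
    ⊢⁻⇒¬Valid' τ ρ κ τΓ≡G (n-conj₂ n) (_ , v) = ⊢⁻⇒¬Valid' τ ρ κ τΓ≡G n v
    ⊢⁻⇒¬Valid' τ ρ κ τΓ≡G (n-all {α = α} n) f =
      ⊢⁻⇒¬Valid' τ _ κ τΓ≡G n (f (nomTm (0 , α)) (AM-nomTm S 0 α))
    ⊢⁻⇒¬Valid' τ ρ κ τΓ≡G (n-ex n) (_ , _ , v) = ⊢⁻⇒¬Valid' τ _ κ τΓ≡G n v
    ⊢⁻⇒¬Valid' τ ρ κ τΓ≡G (n-piC {Γ'} ne n) f =
      ⊢⁻⇒¬Valid' (delN Γ' τ) ρ _ (trans (lookupN-delN-≢ ne τ) τΓ≡G) n (f emp i-emp)

theorem5p1 : (S : Sig) → ⊢sig S →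
    (Ψ : List (ℕ × Ar)) (Ξ : List (ℕ × Schema)) (F : Fm) → WfF S Ψ (dom Ξ) F →
    (θ : TSub) → ClosedSubFor S Ψ θ → (Fθ : Fm) → SubF θ F Fθ →
    (Γ : ℕ) (σ : CSub) → CtxSubFor Ξ Γ σ →
    (G : CtxE) → ClG G → ¬ CtxOK S G →
    (Γ ⊢⁺ F → Valid S (csubF ((Γ , G) ∷ []) (csubF σ Fθ)))
    × (Γ ⊢⁻ F → ¬ Valid S (csubF ((Γ , G) ∷ []) (csubF σ Fθ)))
theorem5p1 S _ _ _ _ _ _ _ _ F[θ] Γ σ (_ , Γ∉σ , _) G clG G-bad =
    (λ p → ⊢⁺⇒Valid' [Γ↦G] [] [] Γ↦G (⊢⁺-csubF σ σΓ≡∅ (⊢⁺-SubF F[θ] p)))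
  , (λ n → ⊢⁻⇒¬Valid' [Γ↦G] [] [] Γ↦G (⊢⁻-csubF σ σΓ≡∅ (⊢⁻-SubF F[θ] n)))
  where
    open IllFormedContext S Γ G clG G-bad

    [Γ↦G] : CSub
    [Γ↦G] = (Γ , G) ∷ []

    Γ↦G : lookupN [Γ↦G] Γ ≡ just G
    Γ↦G rewrite ≡ᵇ-refl Γ = refl

    σΓ≡∅ : lookupN σ Γ ≡ nothing
    σΓ≡∅ = lookupN-∉-dom σ Γ∉σ
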